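{- Every graph $G$ belonging to $SCC1$ is bisimilar to a finite pseudotree: for every vertex $v$ of $G$ there is a finite pseudotree $H$ with root $r$ such that the pointed colored graphs $(G,v)$ and $(H,r)$ are bisimilar.
   Context: $SCC1$ is the class of finite directed (colored) graphs whose strongly connected components all have exactly one vertex (loops are allowed). A finite pseudotree is a finite graph obtained from a finite tree (a graph with a root $r$ such that every vertex has a unique path from $r$) by adding loops to some nodes. A bisimulation between colored graphs $G,H$ is a relation $B\subseteq V(G)\times V(H)$ such that if $vBw$ then $v,w$ satisfy the same predicates, every successor of $v$ is $B$-related to some successor of $w$, and every successor of $w$ is $B$-related to some successor of $v$; $(G,v)$ and $(H,w)$ are bisimilar if some bisimulation relates $v$ and $w$. -}

module Defs where

open import Level using (0ℓ)
open import Data.Nat using (ℕ)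
open import Data.Fin using (Fin)
open import Data.Bool using (Bool; true)
open import Data.List using (List; []; _∷_)
open import Data.Product using (Σ; ∃; _×_)
open import Relation.Nullary using (¬_)
open import Relation.Binary.PropositionalEquality using (_≡_)
open import Relation.Binary.Construct.Closure.ReflexiveTransitive using (Star)

-- A finite directed graph coloured by k unary predicates P₀,…,P_{k-1}.
-- Vertices are Fin size; edge u v = true iff there is an edge u → v
-- (loops allowed); colour v p = true iff v satisfies predicate p.
record Graph (k : ℕ) : Set where
  field
    size   : ℕ
    edge   : Fin size → Fin size → Bool
    colour : Fin size → Fin k → Bool

open Graph public

Vertex : ∀ {k} → Graph k → Set
Vertex G = Fin (size G)

Edge : ∀ {k} (G : Graph k) → Vertex G → Vertex G → Set
Edge G u v = edge G u v ≡ true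

Reach : ∀ {k} (G : Graph k) → Vertex G → Vertex G → Set
Reach G = Star (Edge G)

SCC1 : ∀ {k} → Graph k → Set
SCC1 G = ∀ u v → Reach G u v → Reach G v u → u ≡ v

-- Walks along non-loop edges, recorded by the list of visited vertices
-- after the start: NLPath G u v ps.
data NLPath {k} (G : Graph k) : Vertex G → Vertex G → List (Vertex G) → Set where
  here : ∀ {u} → NLPath G u u []
  step : ∀ {u w v ps} → Edge G u w → ¬ (u ≡ w) → NLPath G w v ps → NLPath G u v (w ∷ ps)

-- (H, r) is a finite pseudotree: removing the loops leaves a tree rooted
-- at r, i.e. every vertex has exactly one (loop-free-edge) path from r.
IsPseudotree : ∀ {k} (H : Graph k) → Vertex H → Set
IsPseudotree H r =
  ∀ v → Σ (List (Vertex H)) (λ ps → NLPath H r v ps)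
      × (∀ ps qs → NLPath H r v ps → NLPath H r v qs → ps ≡ qs)

IsBisimulation : ∀ {k} (G H : Graph k) → (Vertex G → Vertex H → Set) → Set
IsBisimulation G H B =
  ∀ v w → B v w →
    (∀ p → colour G v p ≡ colour H w p)
  × (∀ v' → Edge G v v' → ∃ λ w' → Edge H w w' × B v' w')
  × (∀ w' → Edge H w w' → ∃ λ v' → Edge G v v' × B v' w')

Bisimilar : ∀ {k} (G : Graph k) → Vertex G → (H : Graph k) → Vertex H → Set₁
Bisimilar G v H w =
  Σ (Vertex G → Vertex H → Set) λ B → IsBisimulation G H B × B v w

module Submission where

-- In an SCC1 graph a walk along non-loop edges never revisits
-- a vertex (a revisit would put two distinct vertices in one strongly
-- connected component), so such walks have fewer than |G| edges.  We can
-- therefore unravel G from v by recursion on this bound: the pseudotree of a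
-- vertex u consists of a new root, coloured like u and carrying a loop iff u
-- does, placed above the disjoint union of the pseudotrees of the proper
-- successors of u.

open import Defs
open import Data.Nat using (ℕ; zero; suc; _<_; _≤_; _+_; s≤s⁻¹)
open import Data.Fin using (Fin; zero; suc; _↑ˡ_; _↑ʳ_; splitAt; _≟_)
open import Data.Fin.Properties
  using (splitAt-↑ˡ; splitAt-↑ʳ; splitAt⁻¹-↑ˡ; splitAt⁻¹-↑ʳ; ↑ˡ-injective; ↑ʳ-injective; injective⇒≤; suc-injective)
open import Data.Bool using (Bool; true; false) renaming (_≟_ to _≟ᵇ_)
open import Data.Bool.Properties using (T-≡)
open import Data.List using (List; []; _∷_; _++_; map; length; filter; allFin; lookup)
open import Data.List.Membership.Propositional using (_∈_; _∉_)
open import Data.List.Membership.Propositional.Properties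
  using (∈-filter⁺; ∈-filter⁻; ∈-allFin; ∈-lookup; ∈-++⁻; ∈-++⁺ˡ; ∈-++⁺ʳ)
open import Data.List.Relation.Unary.Any using (here; there)
open import Data.Product using (Σ; ∃; _×_; _,_; proj₁; proj₂)
open import Data.Sum using (_⊎_; inj₁; inj₂; [_,_]′)
open import Data.Empty using (⊥; ⊥-elim)
open import Function.Bundles using (Equivalence)
open import Relation.Nullary using (¬_; Dec; yes; no)
open import Relation.Nullary.Decidable using (_×-dec_; ¬?; ⌊_⌋; toWitness; fromWitness)
open import Relation.Binary.PropositionalEquality using (_≡_; _≢_; refl; sym; trans; cong; cong-app; subst)
open import Relation.Binary.Construct.Closure.ReflexiveTransitive using (ε; _◅_)

data Distinct {A : Set} : List A → Set where
  [] : Distinct []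
  _∷_ : ∀ {x xs} → x ∉ xs → Distinct xs → Distinct (x ∷ xs)

lookup-injective : ∀ {A : Set} (xs : List A) → Distinct xs →
  ∀ i j → lookup xs i ≡ lookup xs j → i ≡ j
lookup-injective (x ∷ xs) (x∉ ∷ d) zero    zero    eq = refl
lookup-injective (x ∷ xs) (x∉ ∷ d) zero    (suc j) eq = ⊥-elim (x∉ (subst (_∈ xs) (sym eq) (∈-lookup j)))
lookup-injective (x ∷ xs) (x∉ ∷ d) (suc i) zero    eq = ⊥-elim (x∉ (subst (_∈ xs) eq (∈-lookup i)))
lookup-injective (x ∷ xs) (x∉ ∷ d) (suc i) (suc j) eq = cong suc (lookup-injective xs d i j eq)

distinct-length : ∀ {n} (xs : List (Fin n)) → Distinct xs → length xs ≤ n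
distinct-length xs d = injective⇒≤ (λ {i} {j} → lookup-injective xs d i j)

module _ {k} (G : Graph k) where

  visited-reachable : ∀ {u v x ps} → x ∈ ps → NLPath G u v ps → Reach G u x
  visited-reachable (here refl) (step e _ p) = e ◅ ε
  visited-reachable (there x∈)  (step e _ p) = e ◅ visited-reachable x∈ p

  -- In an SCC1 graph a loop-free walk never revisits a vertex: a revisited
  -- vertex would be mutually reachable with its (distinct) successor.
  walk-distinct : SCC1 G → ∀ {u v ps} → NLPath G u v ps → Distinct (u ∷ ps)
  walk-distinct scc here = (λ ()) ∷ []
  walk-distinct scc (step {u} {w} {v} {ps} e u≢w p) = u∉ ∷ walk-distinct scc p
    where
    u∉ : u ∉ w ∷ ps
    u∉ (here u≡w)  = u≢w u≡w
    u∉ (there u∈) = u≢w (scc u w (e ◅ ε) (visited-reachable u∈ p))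

  walk-length : SCC1 G → ∀ {u v ps} → NLPath G u v ps → length ps < size G
  walk-length scc {u} {ps = ps} p = distinct-length (u ∷ ps) (walk-distinct scc p)

-- A bisimulation is exactly a relation B with Steps G H B B.
Steps : ∀ {k} (G H : Graph k) → (Vertex G → Vertex H → Set) → (Vertex G → Vertex H → Set) → Set
Steps G H B R =
  ∀ v w → B v w →
    (∀ p → colour G v p ≡ colour H w p)
  × (∀ v' → Edge G v v' → ∃ λ w' → Edge H w w' × R v' w')
  × (∀ w' → Edge H w w' → ∃ λ v' → Edge G v v' × R v' w')

module _ {k} {G H : Graph k} where

  steps-mono : ∀ {B R R'} → (∀ {v w} → R v w → R' v w) → Steps G H B R → Steps G H B R'
  steps-mono R⊆R' st v w b with st v w b
  ... | colours , forth , back =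
    colours ,
    (λ v' e → let (w' , e' , r) = forth v' e in w' , e' , R⊆R' r) ,
    (λ w' e → let (v' , e' , r) = back w' e in v' , e' , R⊆R' r)

  steps-∪ : ∀ {B₁ B₂ R} → Steps G H B₁ R → Steps G H B₂ R →
    Steps G H (λ v w → B₁ v w ⊎ B₂ v w) R
  steps-∪ st₁ st₂ v w (inj₁ b) = st₁ v w b
  steps-∪ st₁ st₂ v w (inj₂ b) = st₂ v w b

record Embedding {k} (A X : Graph k) : Set where
  field
    ι         : Vertex X → Vertex A
    injective : ∀ x y → ι x ≡ ι y → x ≡ y
    closed    : ∀ x a → Edge A (ι x) a → ∃ λ y → a ≡ ι y
    reflects  : ∀ x y → Edge A (ι x) (ι y) → Edge X x y
    preserves : ∀ x y → Edge X x y → Edge A (ι x) (ι y)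
    colours   : ∀ x p → colour A (ι x) p ≡ colour X x p

module _ {k} {A X : Graph k} (E : Embedding A X) where
  open Embedding E

  push : ∀ {x y qs} → NLPath X x y qs → NLPath A (ι x) (ι y) (map ι qs)
  push here = here
  push (step e x≢y p) = step (preserves _ _ e) (λ eq → x≢y (injective _ _ eq)) (push p)

  pull : ∀ {x a ps} → NLPath A (ι x) a ps →
    ∃ λ y → a ≡ ι y × ∃ λ qs → ps ≡ map ι qs × NLPath X x y qs
  pull {x} here = x , refl , [] , refl , here
  pull {x} (step {w = w} e x≢w p) with closed x w e
  ... | y , refl with pull p
  ... | z , a≡ιz , qs , ps≡ , q =
    z , a≡ιz , y ∷ qs , cong (ι y ∷_) ps≡ , step (reflects x y e) (λ eq → x≢w (cong ι eq)) q

  Image : ∀ {G : Graph k} → (Vertex G → Vertex X → Set) → Vertex G → Vertex A → Set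
  Image B g a = ∃ λ x → a ≡ ι x × B g x

  image-bisim : ∀ {G : Graph k} {B} → IsBisimulation G X B → IsBisimulation G A (Image {G} B)
  image-bisim {G} {B} bis g a (x , refl , b) with bis g x b
  ... | same , forth , back = same' , forth' , back'
    where
    same' : ∀ p → colour G g p ≡ colour A (ι x) p
    same' p = trans (same p) (sym (colours x p))
    forth' : ∀ g' → Edge G g g' → ∃ λ a' → Edge A (ι x) a' × Image {G} B g' a'
    forth' g' e with forth g' e
    ... | y , e' , b' = ι y , preserves x y e' , (y , refl , b')
    back' : ∀ a' → Edge A (ι x) a' → ∃ λ g' → Edge G g g' × Image {G} B g' a'
    back' a' e with closed x a' e
    ... | y , refl with back y (reflects x y e)
    ... | g' , e' , b' = g' , e' , (y , refl , b')

record Split {k} (A X Y : Graph k) : Set where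
  field
    left     : Embedding A X
    right    : Embedding A Y
    disjoint : ∀ x y → Embedding.ι left x ≢ Embedding.ι right y
    covers   : ∀ a → (∃ λ x → a ≡ Embedding.ι left x) ⊎ (∃ λ y → a ≡ Embedding.ι right y)

mirror : ∀ {k} {A X Y : Graph k} → Split A X Y → Split A Y X
mirror S = record
  { left     = right
  ; right    = left
  ; disjoint = λ y x eq → disjoint x y (sym eq)
  ; covers   = λ a → [ inj₂ , inj₁ ]′ (covers a) }
  where open Split S

UniquelyRooted : ∀ {k} (F : Graph k) → (Vertex F → Bool) → Vertex F → Set
UniquelyRooted F isRoot t =
    (∃ λ ρ → isRoot ρ ≡ true × ∃ λ ps → NLPath F ρ t ps)
  × (∀ ρ ρ' ps ps' → isRoot ρ ≡ true → isRoot ρ' ≡ true →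
       NLPath F ρ t ps → NLPath F ρ' t ps' → ρ ≡ ρ' × ps ≡ ps')

IsForest : ∀ {k} (F : Graph k) → (Vertex F → Bool) → Set
IsForest F isRoot = ∀ t → UniquelyRooted F isRoot t

module _ {k} {A X Y : Graph k} (S : Split A X Y) where
  open Split S
  open Embedding left

  -- A loop-free walk ending in the X-part starts there, since walks cannot
  -- leave the Y-part; it is then a walk of X.
  origin : ∀ {ρ x ps} → NLPath A ρ (ι x) ps →
    ∃ λ a → ρ ≡ ι a × ∃ λ qs → ps ≡ map ι qs × NLPath X a x qs
  origin {ρ} p with covers ρ
  ... | inj₂ (b , refl) = ⊥-elim (disjoint _ _ (proj₁ (proj₂ (pull right p))))
  ... | inj₁ (a , refl) with pull left p
  ...   | y , x≡y , qs , ps≡ , q with injective _ _ x≡y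
  ...     | refl = a , refl , qs , ps≡ , q

  left-uniquelyRooted : ∀ {rootA rootX} → (∀ x → rootA (ι x) ≡ rootX x) →
    IsForest X rootX → ∀ x → UniquelyRooted A rootA (ι x)
  left-uniquelyRooted {rootA} roots forest x = existence , uniqueness
    where
    existence : ∃ λ ρ → rootA ρ ≡ true × ∃ λ ps → NLPath A ρ (ι x) ps
    existence with proj₁ (forest x)
    ... | ρ , r , qs , q = ι ρ , trans (roots ρ) r , map ι qs , push left q
    uniqueness : ∀ ρ ρ' ps ps' → rootA ρ ≡ true → rootA ρ' ≡ true →
      NLPath A ρ (ι x) ps → NLPath A ρ' (ι x) ps' → ρ ≡ ρ' × ps ≡ ps'
    uniqueness ρ ρ' ps ps' r r' p p' with origin p | origin p'
    ... | a , refl , qs , refl , q | a' , refl , qs' , refl , q'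
      with proj₂ (forest x) a a' qs qs' (trans (sym (roots a)) r) (trans (sym (roots a')) r') q q'
    ...   | refl , refl = refl , refl

  split-bisim : ∀ {G : Graph k} {B₁ B₂} → IsBisimulation G X B₁ → IsBisimulation G Y B₂ →
    IsBisimulation G A (λ g a → Image left {G} B₁ g a ⊎ Image right {G} B₂ g a)
  split-bisim bis₁ bis₂ =
    steps-∪ (steps-mono inj₁ (image-bisim left bis₁)) (steps-mono inj₂ (image-bisim right bis₂))

split-forest : ∀ {k} {A X Y : Graph k} (S : Split A X Y) {rootA rootX rootY} →
  (∀ x → rootA (Embedding.ι (Split.left S) x) ≡ rootX x) →
  (∀ y → rootA (Embedding.ι (Split.right S) y) ≡ rootY y) →
  IsForest X rootX → IsForest Y rootY → IsForest A rootA
split-forest S rootsX rootsY forestX forestY t with Split.covers S t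
... | inj₁ (x , refl) = left-uniquelyRooted S rootsX forestX x
... | inj₂ (y , refl) = left-uniquelyRooted (mirror S) rootsY forestY y

join : ∀ {A : Set} m {n} → (Fin m → A) → (Fin n → A) → Fin (m + n) → A
join m f g x = [ f , g ]′ (splitAt m x)

join-↑ˡ : ∀ {A : Set} m {n} (f : Fin m → A) (g : Fin n → A) i → join m f g (i ↑ˡ n) ≡ f i
join-↑ˡ m {n} f g i rewrite splitAt-↑ˡ m i n = refl

join-↑ʳ : ∀ {A : Set} m {n} (f : Fin m → A) (g : Fin n → A) j → join m f g (m ↑ʳ j) ≡ g j
join-↑ʳ m {n} f g j rewrite splitAt-↑ʳ m n j = refl

↑-view : ∀ m n (x : Fin (m + n)) → (∃ λ i → x ≡ i ↑ˡ n) ⊎ (∃ λ j → x ≡ m ↑ʳ j)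
↑-view m n x with splitAt m x in eq
... | inj₁ i = inj₁ (i , sym (splitAt⁻¹-↑ˡ eq))
... | inj₂ j = inj₂ (j , sym (splitAt⁻¹-↑ʳ eq))

↑ˡ≢↑ʳ : ∀ m n (i : Fin m) (j : Fin n) → i ↑ˡ n ≢ m ↑ʳ j
↑ˡ≢↑ʳ m n i j eq with trans (sym (splitAt-↑ˡ m i n)) (trans (cong (splitAt m) eq) (splitAt-↑ʳ m n j))
... | ()

sumEdge : ∀ {m n} → (Fin m → Fin m → Bool) → (Fin n → Fin n → Bool) →
  Fin m ⊎ Fin n → Fin m ⊎ Fin n → Bool
sumEdge e₁ e₂ (inj₁ i) (inj₁ j) = e₁ i j
sumEdge e₁ e₂ (inj₂ i) (inj₂ j) = e₂ i j
sumEdge e₁ e₂ (inj₁ i) (inj₂ j) = false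
sumEdge e₁ e₂ (inj₂ i) (inj₁ j) = false

_⊕_ : ∀ {k} → Graph k → Graph k → Graph k
F₁ ⊕ F₂ = record
  { size   = size F₁ + size F₂
  ; edge   = λ x y → sumEdge (edge F₁) (edge F₂) (splitAt (size F₁) x) (splitAt (size F₁) y)
  ; colour = join (size F₁) (colour F₁) (colour F₂) }

module _ {k} (F₁ F₂ : Graph k) where
  private
    m = size F₁
    n = size F₂
    A = F₁ ⊕ F₂

    edge-ll : ∀ i j → edge A (i ↑ˡ n) (j ↑ˡ n) ≡ edge F₁ i j
    edge-ll i j rewrite splitAt-↑ˡ m i n | splitAt-↑ˡ m j n = refl
    edge-rr : ∀ i j → edge A (m ↑ʳ i) (m ↑ʳ j) ≡ edge F₂ i j
    edge-rr i j rewrite splitAt-↑ʳ m n i | splitAt-↑ʳ m n j = refl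
    edge-lr : ∀ i j → ¬ Edge A (i ↑ˡ n) (m ↑ʳ j)
    edge-lr i j rewrite splitAt-↑ˡ m i n | splitAt-↑ʳ m n j = λ ()
    edge-rl : ∀ i j → ¬ Edge A (m ↑ʳ i) (j ↑ˡ n)
    edge-rl i j rewrite splitAt-↑ʳ m n i | splitAt-↑ˡ m j n = λ ()

    inl : Embedding A F₁
    inl = record
      { ι         = _↑ˡ n
      ; injective = ↑ˡ-injective n
      ; closed    = closed
      ; reflects  = λ i j e → trans (sym (edge-ll i j)) e
      ; preserves = λ i j e → trans (edge-ll i j) e
      ; colours   = λ i → cong-app (join-↑ˡ m (colour F₁) (colour F₂) i) }
      where
      closed : ∀ i a → Edge A (i ↑ˡ n) a → ∃ λ j → a ≡ j ↑ˡ n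
      closed i a e with ↑-view m n a
      ... | inj₁ (j , a≡) = j , a≡
      ... | inj₂ (j , refl) = ⊥-elim (edge-lr i j e)

    inr : Embedding A F₂
    inr = record
      { ι         = m ↑ʳ_
      ; injective = ↑ʳ-injective m
      ; closed    = closed
      ; reflects  = λ i j e → trans (sym (edge-rr i j)) e
      ; preserves = λ i j e → trans (edge-rr i j) e
      ; colours   = λ j → cong-app (join-↑ʳ m (colour F₁) (colour F₂) j) }
      where
      closed : ∀ i a → Edge A (m ↑ʳ i) a → ∃ λ j → a ≡ m ↑ʳ j
      closed i a e with ↑-view m n a
      ... | inj₂ (j , a≡) = j , a≡
      ... | inj₁ (j , refl) = ⊥-elim (edge-rl i j e)

  ⊕-split : Split (F₁ ⊕ F₂) F₁ F₂
  ⊕-split = record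
    { left = inl ; right = inr ; disjoint = ↑ˡ≢↑ʳ m n ; covers = ↑-view m n }

coneEdge : ∀ {s} → Bool → (Fin s → Bool) → (Fin s → Fin s → Bool) →
  Fin (suc s) → Fin (suc s) → Bool
coneEdge loop isRoot e zero    zero    = loop
coneEdge loop isRoot e zero    (suc t) = isRoot t
coneEdge loop isRoot e (suc s) zero    = false
coneEdge loop isRoot e (suc s) (suc t) = e s t

coneColour : ∀ {k s} → (Fin k → Bool) → (Fin s → Fin k → Bool) → Fin (suc s) → Fin k → Bool
coneColour c col zero    = c
coneColour c col (suc t) = col t

cone : ∀ {k} (c : Fin k → Bool) (loop : Bool) (F : Graph k) (isRoot : Vertex F → Bool) → Graph k
cone c loop F isRoot = record
  { size = suc (size F) ; edge = coneEdge loop isRoot (edge F) ; colour = coneColour c (colour F) }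

module _ {k} (c : Fin k → Bool) (loop : Bool) (F : Graph k) (isRoot : Vertex F → Bool) where
  private
    H = cone c loop F isRoot

  -- F sits in its cone as a closed subgraph (nothing points back at the apex).
  cone-embedding : Embedding H F
  cone-embedding = record
    { ι = suc ; injective = λ _ _ → suc-injective ; closed = closed
    ; reflects = λ _ _ e → e ; preserves = λ _ _ e → e ; colours = λ _ _ → refl }
    where
    closed : ∀ x a → Edge H (suc x) a → ∃ λ y → a ≡ suc y
    closed x zero    ()
    closed x (suc y) _ = y , refl

  apex-to-apex : ∀ {ps} → NLPath H zero zero ps → ps ≡ []
  apex-to-apex here = refl
  apex-to-apex (step {w = zero}  _ 0≢0 _) = ⊥-elim (0≢0 refl)
  apex-to-apex (step {w = suc t} _ _ p) with pull cone-embedding p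
  ... | _ , () , _

  apex-to-F : ∀ {t ps} → NLPath H zero (suc t) ps →
    ∃ λ ρ → isRoot ρ ≡ true × ∃ λ qs → ps ≡ suc ρ ∷ map suc qs × NLPath F ρ t qs
  apex-to-F (step {w = zero}  _ 0≢0 _) = ⊥-elim (0≢0 refl)
  apex-to-F (step {w = suc ρ} e _ p) with pull cone-embedding p
  ... | _ , refl , qs , refl , q = ρ , e , qs , refl , q

  cone-pseudotree : IsForest F isRoot → IsPseudotree H zero
  cone-pseudotree forest zero = ([] , here) , λ ps ps' p p' → trans (apex-to-apex p) (sym (apex-to-apex p'))
  cone-pseudotree forest (suc t) = existence , uniqueness
    where
    existence : ∃ λ ps → NLPath H zero (suc t) ps
    existence with proj₁ (forest t)
    ... | ρ , r , qs , q = suc ρ ∷ map suc qs , step r (λ ()) (push cone-embedding q)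
    uniqueness : ∀ ps ps' → NLPath H zero (suc t) ps → NLPath H zero (suc t) ps' → ps ≡ ps'
    uniqueness ps ps' p p' with apex-to-F p | apex-to-F p'
    ... | ρ , r , qs , refl , q | ρ' , r' , qs' , refl , q'
      with proj₂ (forest t) ρ ρ' qs qs' r r' q q'
    ...   | refl , refl = refl

module Unravelling {k} (G : Graph k) where

  TreeFor : Vertex G → Set₁
  TreeFor u = Σ (Graph k) λ H → Σ (Vertex H) λ r → IsPseudotree H r × Bisimilar G u H r

  record ForestFor (ws : List (Vertex G)) : Set₁ where
    field
      F       : Graph k
      isRoot  : Vertex F → Bool
      forest  : IsForest F isRoot
      B       : Vertex G → Vertex F → Set
      bisim   : IsBisimulation G F B
      covered : ∀ w → w ∈ ws → ∃ λ t → isRoot t ≡ true × B w t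
      rooted  : ∀ t → isRoot t ≡ true → ∃ λ w → w ∈ ws × B w t

  empty-forest : ForestFor []
  empty-forest = record
    { F = record { size = 0 ; edge = λ () ; colour = λ () }
    ; isRoot = λ () ; forest = λ () ; B = λ _ _ → ⊥ ; bisim = λ _ ()
    ; covered = λ _ () ; rooted = λ () }

  tree-forest : ∀ {w} → TreeFor w → ForestFor (w ∷ [])
  tree-forest {w} (H , r , pseudotree , B , bisim , wBr) = record
    { F = H ; isRoot = isRoot ; forest = forest ; B = B ; bisim = bisim
    ; covered = covered ; rooted = rooted }
    where
    isRoot : Vertex H → Bool
    isRoot t = ⌊ t ≟ r ⌋
    root-is-r : ∀ {t} → isRoot t ≡ true → t ≡ r
    root-is-r {t} eq = toWitness {a? = t ≟ r} (Equivalence.from T-≡ eq)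
    r-is-root : isRoot r ≡ true
    r-is-root = Equivalence.to T-≡ (fromWitness {a? = r ≟ r} refl)
    forest : IsForest H isRoot
    forest t = (r , r-is-root , proj₁ (pseudotree t)) , uniqueness
      where
      uniqueness : ∀ ρ ρ' ps ps' → isRoot ρ ≡ true → isRoot ρ' ≡ true →
        NLPath H ρ t ps → NLPath H ρ' t ps' → ρ ≡ ρ' × ps ≡ ps'
      uniqueness ρ ρ' ps ps' r₁ r₂ p p' with root-is-r r₁ | root-is-r r₂
      ... | refl | refl = refl , proj₂ (pseudotree t) ps ps' p p'
    covered : ∀ w' → w' ∈ w ∷ [] → ∃ λ t → isRoot t ≡ true × B w' t
    covered w' (here refl) = r , r-is-root , wBr
    rooted : ∀ t → isRoot t ≡ true → ∃ λ w' → w' ∈ w ∷ [] × B w' t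
    rooted t t-root with root-is-r t-root
    ... | refl = w , here refl , wBr

  forest-union : ∀ {ws₁ ws₂} → ForestFor ws₁ → ForestFor ws₂ → ForestFor (ws₁ ++ ws₂)
  forest-union {ws₁} {ws₂} X₁ X₂ = record
    { F = X₁.F ⊕ X₂.F ; isRoot = isRoot ; B = B
    ; forest = split-forest S (join-↑ˡ m X₁.isRoot X₂.isRoot) (join-↑ʳ m X₁.isRoot X₂.isRoot)
                 X₁.forest X₂.forest
    ; bisim = split-bisim S X₁.bisim X₂.bisim
    ; covered = covered ; rooted = rooted }
    where
    module X₁ = ForestFor X₁
    module X₂ = ForestFor X₂
    S = ⊕-split X₁.F X₂.F
    m = size X₁.F
    n = size X₂.F
    isRoot : Vertex (X₁.F ⊕ X₂.F) → Bool
    isRoot = join m X₁.isRoot X₂.isRoot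
    B : Vertex G → Vertex (X₁.F ⊕ X₂.F) → Set
    B g a = Image (Split.left S) {G} X₁.B g a ⊎ Image (Split.right S) {G} X₂.B g a
    covered : ∀ w → w ∈ ws₁ ++ ws₂ → ∃ λ t → isRoot t ≡ true × B w t
    covered w w∈ with ∈-++⁻ ws₁ w∈
    ... | inj₁ w∈₁ = let (t , r , b) = X₁.covered w w∈₁ in
      t ↑ˡ n , trans (join-↑ˡ m X₁.isRoot X₂.isRoot t) r , inj₁ (t , refl , b)
    ... | inj₂ w∈₂ = let (t , r , b) = X₂.covered w w∈₂ in
      m ↑ʳ t , trans (join-↑ʳ m X₁.isRoot X₂.isRoot t) r , inj₂ (t , refl , b)
    rooted : ∀ t → isRoot t ≡ true → ∃ λ w → w ∈ ws₁ ++ ws₂ × B w t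
    rooted t r with ↑-view m n t
    ... | inj₁ (i , refl) = let (w , w∈ , b) = X₁.rooted i (trans (sym (join-↑ˡ m X₁.isRoot X₂.isRoot i)) r) in
      w , ∈-++⁺ˡ w∈ , inj₁ (i , refl , b)
    ... | inj₂ (j , refl) = let (w , w∈ , b) = X₂.rooted j (trans (sym (join-↑ʳ m X₁.isRoot X₂.isRoot j)) r) in
      w , ∈-++⁺ʳ ws₁ w∈ , inj₂ (j , refl , b)

  forest-of : (ws : List (Vertex G)) → (∀ w → w ∈ ws → TreeFor w) → ForestFor ws
  forest-of []       trees = empty-forest
  forest-of (w ∷ ws) trees =
    forest-union (tree-forest (trees w (here refl))) (forest-of ws (λ w' w'∈ → trees w' (there w'∈)))

  isProperSuccessor? : ∀ u w → Dec (Edge G u w × u ≢ w)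
  isProperSuccessor? u w = (edge G u w ≟ᵇ true) ×-dec ¬? (u ≟ w)

  properSuccessors : Vertex G → List (Vertex G)
  properSuccessors u = filter (isProperSuccessor? u) (allFin (size G))

  cone-tree : ∀ u → ForestFor (properSuccessors u) → TreeFor u
  cone-tree u X = H , zero , cone-pseudotree c loop X.F X.isRoot X.forest , BH , bisim , inj₁ (refl , refl)
    where
    module X = ForestFor X
    c = colour G u
    loop = edge G u u
    H = cone c loop X.F X.isRoot
    E = cone-embedding c loop X.F X.isRoot
    BH : Vertex G → Vertex H → Set
    BH g a = (g ≡ u × a ≡ zero) ⊎ Image E {G} X.B g a
    apex-steps : Steps G H (λ g a → g ≡ u × a ≡ zero) BH
    apex-steps g a (refl , refl) = (λ p → refl) , forth , back
      where
      forth : ∀ g' → Edge G u g' → ∃ λ a' → Edge H zero a' × BH g' a'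
      forth g' e with u ≟ g'
      ... | yes refl = zero , e , inj₁ (refl , refl)
      ... | no u≢g' with X.covered g' (∈-filter⁺ (isProperSuccessor? u) (∈-allFin g') (e , u≢g'))
      ...   | t , r , b = suc t , r , inj₂ (t , refl , b)
      back : ∀ a' → Edge H zero a' → ∃ λ g' → Edge G u g' × BH g' a'
      back zero    e = u , e , inj₁ (refl , refl)
      back (suc t) e with X.rooted t e
      ... | w , w∈ , b =
        w , proj₁ (proj₂ (∈-filter⁻ (isProperSuccessor? u) {xs = allFin (size G)} w∈)) , inj₂ (t , refl , b)
    bisim : IsBisimulation G H BH
    bisim = steps-∪ apex-steps (steps-mono inj₂ (image-bisim E X.bisim))

  ShortWalks : ℕ → Vertex G → Set
  ShortWalks f u = ∀ v ps → NLPath G u v ps → length ps < f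

  -- Unravelling by recursion on the walk-length bound, which drops by one
  -- when passing to a proper successor.
  unravel : ∀ f u → ShortWalks f u → TreeFor u
  unravel zero    u short with short u [] here
  ... | ()
  unravel (suc f) u short =
    cone-tree u (forest-of (properSuccessors u) (λ w w∈ → unravel f w (successor-short w∈)))
    where
    successor-short : ∀ {w} → w ∈ properSuccessors u → ShortWalks f w
    successor-short w∈ v ps p with ∈-filter⁻ (isProperSuccessor? u) {xs = allFin (size G)} w∈
    ... | _ , e , u≢w = s≤s⁻¹ (short v (_ ∷ ps) (step e u≢w p))

lemma3 : ∀ (k : ℕ) (G : Graph k) → SCC1 G → (v : Vertex G) →
    Σ (Graph k) λ H → Σ (Vertex H) λ r → IsPseudotree H r × Bisimilar G v H r
lemma3 k G scc v = Unravelling.unravel G (size G) v (λ _ _ p → walk-length G scc p)
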